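{- For integers $q\geq 0$ and $0\leq n_1\leq n$, and for $x\in\mathbb{C}$, $$\sum_{k=0}^{n_1}(-1)^{n-k}\binom{n}{k}\binom{k+x+q+n-2}{q+n-1}=\sum_{k=0}^{n_1}(-1)^{n-n_1}\binom{n}{k}\binom{x+q+n-2}{q+n-1-k}\binom{n-k-1}{n_1-k}.$$
   Context: For complex $a$ and integer $b$, $\binom{a}{b}=a(a-1)\cdots(a-b+1)/b!$ if $b\geq 0$ and $\binom{a}{b}=0$ if $b<0$ (in particular $\binom{ -1}{0}=1$). -}

module Defs where

open import Level using (Level; _⊔_) renaming (suc to lsuc)
open import Algebra.Bundles using (CommutativeRing)
open import Data.Nat as ℕ using (ℕ; zero; suc)
open import Data.Integer as ℤ using (ℤ; +_; -[1+_])

module RingOps {c ℓ : Level} (R : CommutativeRing c ℓ) where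
  open CommutativeRing R hiding (zero)

  fromℕ : ℕ → Carrier
  fromℕ zero    = 0#
  fromℕ (suc n) = 1# + fromℕ n

  fromℤ : ℤ → Carrier
  fromℤ (+ n)      = fromℕ n
  fromℤ -[1+ n ]   = - fromℕ (suc n)

  sign : ℕ → Carrier
  sign zero    = 1#
  sign (suc m) = - sign m

  sumTo : ℕ → (ℕ → Carrier) → Carrier
  sumTo zero    f = f zero
  sumTo (suc n) f = sumTo n f + f (suc n)

-- A ℚ-algebra: a commutative ring in which every positive integer is
-- invertible (e.g. ℚ, ℝ, ℂ).  inv n is the inverse of n+1.
record QAlgebra (c ℓ : Level) : Set (lsuc (c ⊔ ℓ)) where
  field
    commRing : CommutativeRing c ℓ
  open CommutativeRing commRing hiding (zero)
  open RingOps commRing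
  field
    inv     : ℕ → Carrier
    inv-correct : ∀ n → fromℕ (suc n) * inv n ≈ 1#

module QOps {c ℓ : Level} (A : QAlgebra c ℓ) where
  open QAlgebra A
  open CommutativeRing commRing hiding (zero)
  open RingOps commRing public

  -- generalized binomial coefficient with natural lower index:
  -- binomℕ a b = a (a-1) ... (a-b+1) / b!
  -- (via binom a (b+1) = binom a b * (a - b) / (b+1))
  binomℕ : Carrier → ℕ → Carrier
  binomℕ a zero    = 1#
  binomℕ a (suc b) = (binomℕ a b * (a - fromℕ b)) * inv b

  binom : Carrier → ℤ → Carrier
  binom a (+ b)    = binomℕ a b
  binom a -[1+ b ] = 0#

module Submission where

open import Defs
open import Level using (Level)
open import Algebra.Bundles using (CommutativeRing)
open import Data.Nat as ℕ using (ℕ; zero; suc; _≤_; _∸_)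
import Data.Nat.Properties as ℕP
open import Data.Integer as ℤ using (ℤ; +_; -[1+_])
import Data.Integer.Properties as ℤP
import Data.Sign as Sign
open import Data.Maybe using (Maybe; just; nothing)
open import Relation.Nullary using (yes; no)
import Relation.Binary.PropositionalEquality as P
import Algebra.Solver.Ring.AlmostCommutativeRing as ACR

-- Writing y = x+q+n-2 and m = q+n-1, this is the case of an identity that
-- holds for every y and every integer m (PartialAlternatingSum.partial-sum),
-- proved by induction on n₁.  Passing from n₁ to n₁+1 adds the summand
-- (-1)^{n-n₁-1} C(n,n₁+1) C(n₁+1+y, m) on the left; Vandermonde's convolution
-- and trinomial revision turn it into Σ_k (-1)^{n-n₁-1} C(n,k) C(y,m-k) C(n-k, n₁+1-k),
-- and Pascal's rule C(n-k, n₁+1-k) = C(n-k-1, n₁-k) + C(n-k-1, n₁+1-k) together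
-- with the sign change merges it with the old right-hand side.

module IndexArithmetic where
  open P using (_≡_)
  open P.≡-Reasoning

  minus-suc : ∀ m k → m ℤ.- + suc k ≡ ℤ.pred m ℤ.- + k
  minus-suc m k = begin
    m ℤ.+ -[1+ k ]                  ≡⟨ P.cong (λ i → m ℤ.+ i) (split k) ⟩
    m ℤ.+ (ℤ.-1ℤ ℤ.+ ℤ.- + k)       ≡⟨ P.sym (ℤP.+-assoc m ℤ.-1ℤ (ℤ.- + k)) ⟩
    (m ℤ.+ ℤ.-1ℤ) ℤ.+ ℤ.- + k       ≡⟨ P.cong (λ i → i ℤ.+ ℤ.- + k) (ℤP.+-comm m ℤ.-1ℤ) ⟩
    ℤ.pred m ℤ.- + k                ∎
    where
    split : ∀ k → -[1+ k ] ≡ ℤ.-1ℤ ℤ.+ ℤ.- + k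
    split zero    = P.refl
    split (suc k) = P.refl

  minus-≥ : ∀ {j k} → k ≤ j → + j ℤ.- + k ≡ + (j ∸ k)
  minus-≥ {j} {k} k≤j = P.trans (ℤP.m-n≡m⊖n j k) (ℤP.⊖-≥ k≤j)

  suc-minus : ∀ a k → ℤ.suc (+ a ℤ.- + k) ≡ + suc a ℤ.- + k
  suc-minus a k = P.sym (ℤP.+-assoc (+ 1) (+ a) (ℤ.- + k))

  minus-next : ∀ a → + a ℤ.- + suc a ≡ -[1+ 0 ]
  minus-next a = P.trans (ℤP.m-n≡m⊖n a (suc a)) (⊖-next a)
    where
    ⊖-next : ∀ a → a ℤ.⊖ suc a ≡ -[1+ 0 ]
    ⊖-next zero    = P.refl
    ⊖-next (suc a) = P.trans (ℤP.[1+m]⊖[1+n]≡m⊖n a (suc a)) (⊖-next a)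

open IndexArithmetic

-- The canonical map ℤ → R into a commutative ring is a ring homomorphism.
-- This makes the ring solver with integer coefficients available in R.
module IntegerCast {c ℓ : Level} (R : CommutativeRing c ℓ) where
  open CommutativeRing R hiding (zero)
  open RingOps R
  open import Relation.Binary.Reasoning.Setoid setoid
  open import Algebra.Definitions.RawMonoid +-rawMonoid using (_×_)
  open import Algebra.Properties.Monoid.Mult +-monoid using (×-homo-+)
  open import Algebra.Properties.Semiring.Mult semiring using (×1-homo-*)
  open import Algebra.Properties.Ring ring using (-‿distribˡ-*; -‿distribʳ-*)
  open import Algebra.Properties.AbelianGroup +-abelianGroup
    using (⁻¹-∙-comm; ε⁻¹≈ε; ⁻¹-involutive)

  fromℕ≈× : ∀ n → fromℕ n ≈ n × 1#
  fromℕ≈× zero    = refl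
  fromℕ≈× (suc n) = +-congˡ (fromℕ≈× n)

  fromℕ-+ : ∀ a b → fromℕ (a ℕ.+ b) ≈ fromℕ a + fromℕ b
  fromℕ-+ a b = begin
    fromℕ (a ℕ.+ b)        ≈⟨ fromℕ≈× (a ℕ.+ b) ⟩
    (a ℕ.+ b) × 1#         ≈⟨ ×-homo-+ 1# a b ⟩
    a × 1# + b × 1#        ≈⟨ sym (+-cong (fromℕ≈× a) (fromℕ≈× b)) ⟩
    fromℕ a + fromℕ b      ∎

  fromℕ-* : ∀ a b → fromℕ (a ℕ.* b) ≈ fromℕ a * fromℕ b
  fromℕ-* a b = begin
    fromℕ (a ℕ.* b)        ≈⟨ fromℕ≈× (a ℕ.* b) ⟩
    (a ℕ.* b) × 1#         ≈⟨ ×1-homo-* a b ⟩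
    (a × 1#) * (b × 1#)    ≈⟨ sym (*-cong (fromℕ≈× a) (fromℕ≈× b)) ⟩
    fromℕ a * fromℕ b      ∎

  -- ℤ addition is defined through a ⊖ b = a - b for naturals a, b
  fromℤ-⊖ : ∀ a b → fromℤ (a ℤ.⊖ b) ≈ fromℕ a - fromℕ b
  fromℤ-⊖ zero    zero    = sym (trans (+-identityˡ _) ε⁻¹≈ε)
  fromℤ-⊖ zero    (suc b) = sym (+-identityˡ _)
  fromℤ-⊖ (suc a) zero    = sym (trans (+-congˡ ε⁻¹≈ε) (+-identityʳ _))
  fromℤ-⊖ (suc a) (suc b) = begin
    fromℤ (suc a ℤ.⊖ suc b)          ≡⟨ P.cong fromℤ (ℤP.[1+m]⊖[1+n]≡m⊖n a b) ⟩
    fromℤ (a ℤ.⊖ b)                  ≈⟨ fromℤ-⊖ a b ⟩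
    fromℕ a - fromℕ b                ≈⟨ sym (shift-cancel (fromℕ a) (fromℕ b)) ⟩
    (1# + fromℕ a) - (1# + fromℕ b)  ∎
    where
    shift-cancel : ∀ u v → (1# + u) - (1# + v) ≈ u - v
    shift-cancel u v = begin
      (1# + u) + - (1# + v)     ≈⟨ +-congˡ (sym (⁻¹-∙-comm 1# v)) ⟩
      (1# + u) + (- 1# + - v)   ≈⟨ +-congʳ (+-comm 1# u) ⟩
      (u + 1#) + (- 1# + - v)   ≈⟨ +-assoc u 1# _ ⟩
      u + (1# + (- 1# + - v))   ≈⟨ +-congˡ (sym (+-assoc 1# (- 1#) (- v))) ⟩
      u + ((1# - 1#) + - v)     ≈⟨ +-congˡ (+-congʳ (-‿inverseʳ 1#)) ⟩
      u + (0# + - v)            ≈⟨ +-congˡ (+-identityˡ (- v)) ⟩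
      u - v                     ∎

  -- ℤ multiplication is defined through signed naturals s ◃ k
  fromℤ-+◃ : ∀ k → fromℤ (Sign.+ ℤ.◃ k) ≈ fromℕ k
  fromℤ-+◃ zero    = refl
  fromℤ-+◃ (suc k) = refl

  fromℤ--◃ : ∀ k → fromℤ (Sign.- ℤ.◃ k) ≈ - fromℕ k
  fromℤ--◃ zero    = sym ε⁻¹≈ε
  fromℤ--◃ (suc k) = refl

  fromℤ-+ : ∀ i j → fromℤ (i ℤ.+ j) ≈ fromℤ i + fromℤ j
  fromℤ-+ (+ a)    (+ b)    = fromℕ-+ a b
  fromℤ-+ (+ a)    -[1+ b ] = fromℤ-⊖ a (suc b)
  fromℤ-+ -[1+ a ] (+ b)    = trans (fromℤ-⊖ b (suc a)) (+-comm _ _)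
  fromℤ-+ -[1+ a ] -[1+ b ] = begin
    - fromℕ (suc (suc (a ℕ.+ b)))     ≡⟨ P.cong (λ z → - fromℕ (suc z)) (P.sym (ℕP.+-suc a b)) ⟩
    - fromℕ (suc a ℕ.+ suc b)         ≈⟨ -‿cong (fromℕ-+ (suc a) (suc b)) ⟩
    - (fromℕ (suc a) + fromℕ (suc b)) ≈⟨ sym (⁻¹-∙-comm _ _) ⟩
    - fromℕ (suc a) + - fromℕ (suc b) ∎

  fromℤ-* : ∀ i j → fromℤ (i ℤ.* j) ≈ fromℤ i * fromℤ j
  fromℤ-* (+ a) (+ b) = trans (fromℤ-+◃ (a ℕ.* b)) (fromℕ-* a b)
  fromℤ-* (+ a) -[1+ b ] = begin
    fromℤ (Sign.- ℤ.◃ (a ℕ.* suc b)) ≈⟨ fromℤ--◃ (a ℕ.* suc b) ⟩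
    - fromℕ (a ℕ.* suc b)            ≈⟨ -‿cong (fromℕ-* a (suc b)) ⟩
    - (fromℕ a * fromℕ (suc b))      ≈⟨ -‿distribʳ-* _ _ ⟩
    fromℕ a * - fromℕ (suc b)        ∎
  fromℤ-* -[1+ a ] (+ b) = begin
    fromℤ (Sign.- ℤ.◃ (suc a ℕ.* b)) ≈⟨ fromℤ--◃ (suc a ℕ.* b) ⟩
    - fromℕ (suc a ℕ.* b)            ≈⟨ -‿cong (fromℕ-* (suc a) b) ⟩
    - (fromℕ (suc a) * fromℕ b)      ≈⟨ -‿distribˡ-* _ _ ⟩
    - fromℕ (suc a) * fromℕ b        ∎
  fromℤ-* -[1+ a ] -[1+ b ] = begin
    fromℤ (Sign.+ ℤ.◃ (suc a ℕ.* suc b)) ≈⟨ fromℤ-+◃ (suc a ℕ.* suc b) ⟩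
    fromℕ (suc a ℕ.* suc b)              ≈⟨ fromℕ-* (suc a) (suc b) ⟩
    fromℕ (suc a) * fromℕ (suc b)        ≈⟨ sym (⁻¹-involutive _) ⟩
    - - (fromℕ (suc a) * fromℕ (suc b))  ≈⟨ -‿cong (-‿distribˡ-* _ _) ⟩
    - (- fromℕ (suc a) * fromℕ (suc b))  ≈⟨ -‿distribʳ-* _ _ ⟩
    - fromℕ (suc a) * - fromℕ (suc b)    ∎

  fromℤ-neg : ∀ i → fromℤ (ℤ.- i) ≈ - fromℤ i
  fromℤ-neg (+ zero)  = sym ε⁻¹≈ε
  fromℤ-neg (+ suc a) = refl
  fromℤ-neg -[1+ a ]  = sym (⁻¹-involutive _)

  -- A variant of fromℕ/fromℤ with fromℕ′ 1 = 1# on the nose, so that the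
  -- solver constants con (+ 1) and con (+ 0) denote exactly 1# and 0#.
  fromℕ′ : ℕ → Carrier
  fromℕ′ zero          = 0#
  fromℕ′ (suc zero)    = 1#
  fromℕ′ (suc (suc n)) = 1# + fromℕ′ (suc n)

  fromℕ′≈fromℕ : ∀ n → fromℕ′ n ≈ fromℕ n
  fromℕ′≈fromℕ zero          = refl
  fromℕ′≈fromℕ (suc zero)    = sym (+-identityʳ 1#)
  fromℕ′≈fromℕ (suc (suc n)) = +-congˡ (fromℕ′≈fromℕ (suc n))

  fromℤ′ : ℤ → Carrier
  fromℤ′ (+ n)    = fromℕ′ n
  fromℤ′ -[1+ n ] = - fromℕ′ (suc n)

  fromℤ′≈fromℤ : ∀ i → fromℤ′ i ≈ fromℤ i
  fromℤ′≈fromℤ (+ n)    = fromℕ′≈fromℕ n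
  fromℤ′≈fromℤ -[1+ n ] = -‿cong (fromℕ′≈fromℕ (suc n))

  fromℤ′-morphism : ℤ.+-*-rawRing ACR.-Raw-AlmostCommutative⟶ ACR.fromCommutativeRing R
  fromℤ′-morphism = record
    { ⟦_⟧    = fromℤ′
    ; +-homo = λ i j → transport (ℤ._+_ i j) (fromℤ-+ i j) (+-cong (e i) (e j))
    ; *-homo = λ i j → transport (ℤ._*_ i j) (fromℤ-* i j) (*-cong (e i) (e j))
    ; -‿homo = λ i → transport (ℤ.- i) (fromℤ-neg i) (-‿cong (e i))
    ; 0-homo = refl
    ; 1-homo = refl
    }
    where
    e = fromℤ′≈fromℤ
    transport : ∀ i {u v} → fromℤ i ≈ u → v ≈ u → fromℤ′ i ≈ v
    transport i p q = trans (e i) (trans p (sym q))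

  coefficient≟ : ∀ i j → Maybe (fromℤ′ i ≈ fromℤ′ j)
  coefficient≟ i j with i ℤ.≟ j
  ... | yes P.refl = just refl
  ... | no _       = nothing

  open import Algebra.Solver.Ring ℤ.+-*-rawRing (ACR.fromCommutativeRing R)
    fromℤ′-morphism coefficient≟ public

  :1 : ∀ {n} → Polynomial n
  :1 = con (+ 1)

  :0 : ∀ {n} → Polynomial n
  :0 = con (+ 0)

  fromℤ-pred : ∀ i → 1# + fromℤ (i ℤ.- + 1) ≈ fromℤ i
  fromℤ-pred i = begin
    1# + fromℤ (i ℤ.+ -[1+ 0 ])   ≈⟨ +-congˡ (fromℤ-+ i -[1+ 0 ]) ⟩
    1# + (fromℤ i - (1# + 0#))    ≈⟨ solve 1 (λ x → :1 :+ (x :- (:1 :+ :0)) := x) refl (fromℤ i) ⟩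
    fromℤ i                       ∎

  fromℕ-∸ : ∀ {n k} → k ≤ n → fromℕ n - fromℕ k ≈ fromℕ (n ∸ k)
  fromℕ-∸ {n} {k} k≤n = begin
    fromℕ n - fromℕ k                    ≡⟨ P.cong (λ z → fromℕ z - fromℕ k) (P.sym (ℕP.m+[n∸m]≡n k≤n)) ⟩
    fromℕ (k ℕ.+ (n ∸ k)) - fromℕ k      ≈⟨ +-congʳ (fromℕ-+ k (n ∸ k)) ⟩
    (fromℕ k + fromℕ (n ∸ k)) - fromℕ k
      ≈⟨ solve 2 (λ a b → (a :+ b) :- a := b) refl (fromℕ k) (fromℕ (n ∸ k)) ⟩
    fromℕ (n ∸ k)                        ∎

module FiniteSums {c ℓ : Level} (R : CommutativeRing c ℓ) where
  open CommutativeRing R hiding (zero)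
  open RingOps R
  open import Algebra.Properties.CommutativeSemigroup +-commutativeSemigroup
    using (interchange)

  sumTo-cong≤ : ∀ n {f g : ℕ → Carrier} → (∀ k → k ≤ n → f k ≈ g k) →
                sumTo n f ≈ sumTo n g
  sumTo-cong≤ zero    h = h 0 ℕ.z≤n
  sumTo-cong≤ (suc n) h =
    +-cong (sumTo-cong≤ n (λ k k≤n → h k (ℕP.m≤n⇒m≤1+n k≤n))) (h (suc n) ℕP.≤-refl)

  sumTo-cong : ∀ n {f g : ℕ → Carrier} → (∀ k → f k ≈ g k) → sumTo n f ≈ sumTo n g
  sumTo-cong n h = sumTo-cong≤ n (λ k _ → h k)

  sumTo-+ : ∀ n (f g : ℕ → Carrier) →
            sumTo n (λ k → f k + g k) ≈ sumTo n f + sumTo n g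
  sumTo-+ zero    f g = refl
  sumTo-+ (suc n) f g = trans (+-congʳ (sumTo-+ n f g)) (interchange _ _ _ _)

  sumTo-*ˡ : ∀ n a (f : ℕ → Carrier) → a * sumTo n f ≈ sumTo n (λ k → a * f k)
  sumTo-*ˡ zero    a f = refl
  sumTo-*ˡ (suc n) a f = trans (distribˡ a _ _) (+-congʳ (sumTo-*ˡ n a f))

  sumTo-shift : ∀ n (f : ℕ → Carrier) → sumTo (suc n) f ≈ f 0 + sumTo n (λ k → f (suc k))
  sumTo-shift zero    f = refl
  sumTo-shift (suc n) f = trans (+-congʳ (sumTo-shift n f)) (+-assoc _ _ _)

  sumTo-dropLast : ∀ n (f : ℕ → Carrier) → f (suc n) ≈ 0# → sumTo (suc n) f ≈ sumTo n f
  sumTo-dropLast n f f≈0 = trans (+-congˡ f≈0) (+-identityʳ _)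

module Binomials {c ℓ : Level} (A : QAlgebra c ℓ) where
  open QAlgebra A
  open CommutativeRing commRing hiding (zero)
  open QOps A
  open IntegerCast commRing
  open FiniteSums commRing
  open import Relation.Binary.Reasoning.Setoid setoid
  open import Algebra.Properties.CommutativeSemigroup +-commutativeSemigroup
    using (x∙yz≈y∙xz)

  binomℕ-step : ∀ a k → binomℕ a (suc k) * fromℕ (suc k) ≈ binomℕ a k * (a - fromℕ k)
  binomℕ-step a k = begin
    binomℕ a k * (a - fromℕ k) * inv k * fromℕ (suc k)   ≈⟨ *-assoc _ _ _ ⟩
    binomℕ a k * (a - fromℕ k) * (inv k * fromℕ (suc k)) ≈⟨ *-congˡ (trans (*-comm _ _) (inv-correct k)) ⟩
    binomℕ a k * (a - fromℕ k) * 1#                      ≈⟨ *-identityʳ _ ⟩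
    binomℕ a k * (a - fromℕ k)                           ∎

  *-cancel-suc : ∀ k {u v} → u * fromℕ (suc k) ≈ v * fromℕ (suc k) → u ≈ v
  *-cancel-suc k {u} {v} eq = begin
    u                          ≈⟨ sym (*-identityʳ u) ⟩
    u * 1#                     ≈⟨ *-congˡ (sym (inv-correct k)) ⟩
    u * (fromℕ (suc k) * inv k) ≈⟨ sym (*-assoc _ _ _) ⟩
    u * fromℕ (suc k) * inv k  ≈⟨ *-congʳ eq ⟩
    v * fromℕ (suc k) * inv k  ≈⟨ *-assoc _ _ _ ⟩
    v * (fromℕ (suc k) * inv k) ≈⟨ *-congˡ (inv-correct k) ⟩
    v * 1#                     ≈⟨ *-identityʳ v ⟩
    v                          ∎

  binomℕ-cong : ∀ {a b} k → a ≈ b → binomℕ a k ≈ binomℕ b k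
  binomℕ-cong zero    a≈b = refl
  binomℕ-cong (suc k) a≈b = *-congʳ (*-cong (binomℕ-cong k a≈b) (+-congʳ a≈b))

  binom-cong : ∀ {a b} i → a ≈ b → binom a i ≈ binom b i
  binom-cong (+ k)    a≈b = binomℕ-cong k a≈b
  binom-cong -[1+ k ] a≈b = refl

  pascal : ∀ a k → binomℕ (1# + a) (suc k) ≈ binomℕ a k + binomℕ a (suc k)
  pascal a zero = *-cancel-suc 0 (begin
    binomℕ (1# + a) 1 * fromℕ 1  ≈⟨ binomℕ-step (1# + a) 0 ⟩
    1# * ((1# + a) - 0#)
      ≈⟨ solve 1 (λ a → :1 :* ((:1 :+ a) :- :0) := (:1 :+ :0) :+ :1 :* (a :- :0)) refl a ⟩
    fromℕ 1 + 1# * (a - 0#)      ≈⟨ +-congˡ (sym (binomℕ-step a 0)) ⟩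
    fromℕ 1 + binomℕ a 1 * fromℕ 1
      ≈⟨ solve 1 (λ v → (:1 :+ :0) :+ v :* (:1 :+ :0) := (:1 :+ v) :* (:1 :+ :0)) refl (binomℕ a 1) ⟩
    (1# + binomℕ a 1) * fromℕ 1  ∎)
  pascal a (suc k) = *-cancel-suc (suc k) (begin
    binomℕ (1# + a) (suc (suc k)) * fromℕ (suc (suc k)) ≈⟨ binomℕ-step (1# + a) (suc k) ⟩
    binomℕ (1# + a) (suc k) * ((1# + a) - (1# + t))     ≈⟨ *-congʳ (pascal a k) ⟩
    (u + v) * ((1# + a) - (1# + t))
      ≈⟨ solve 4 (λ a t u v → (u :+ v) :* ((:1 :+ a) :- (:1 :+ t)) := u :* (a :- t) :+ v :* (a :- t)) refl a t u v ⟩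
    u * (a - t) + v * (a - t)                           ≈⟨ +-congʳ (sym (binomℕ-step a k)) ⟩
    v * (1# + t) + v * (a - t)
      ≈⟨ solve 3 (λ a t v → v :* (:1 :+ t) :+ v :* (a :- t) := v :* (:1 :+ (:1 :+ t)) :+ v :* (a :- (:1 :+ t))) refl a t v ⟩
    v * (1# + (1# + t)) + v * (a - (1# + t))            ≈⟨ +-congˡ (sym (binomℕ-step a (suc k))) ⟩
    v * fromℕ (suc (suc k)) + w * fromℕ (suc (suc k))   ≈⟨ sym (distribʳ _ v w) ⟩
    (v + w) * fromℕ (suc (suc k))                       ∎)
    where
    t = fromℕ k
    u = binomℕ a k
    v = binomℕ a (suc k)
    w = binomℕ a (suc (suc k))

  pascal-ℤ : ∀ a i → binom (1# + a) (ℤ.suc i) ≈ binom a i + binom a (ℤ.suc i)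
  pascal-ℤ a (+ k)          = pascal a k
  pascal-ℤ a -[1+ zero ]    = sym (+-identityˡ 1#)
  pascal-ℤ a -[1+ suc k ]   = sym (+-identityˡ 0#)

  binomℕ-vanish : ∀ j → binomℕ (fromℕ j) (suc j) ≈ 0#
  binomℕ-vanish j = begin
    binomℕ (fromℕ j) j * (fromℕ j - fromℕ j) * inv j ≈⟨ *-congʳ (*-congˡ (-‿inverseʳ (fromℕ j))) ⟩
    binomℕ (fromℕ j) j * 0# * inv j                  ≈⟨ *-congʳ (zeroʳ _) ⟩
    0# * inv j                                       ≈⟨ zeroˡ _ ⟩
    0#                                               ∎

  pascal-sum : ∀ j (f : ℕ → Carrier) →
    sumTo j (λ k → binomℕ (fromℕ j) k * f (suc k)) + sumTo j (λ k → binomℕ (fromℕ j) k * f k)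
    ≈ sumTo (suc j) (λ k → binomℕ (fromℕ (suc j)) k * f k)
  pascal-sum j f = begin
    S + sumTo j (λ k → B k * f k)                         ≈⟨ +-congˡ (sym (sumTo-dropLast j _ top)) ⟩
    S + sumTo (suc j) (λ k → B k * f k)                   ≈⟨ +-congˡ (sumTo-shift j _) ⟩
    S + (B 0 * f 0 + S′)                                  ≈⟨ x∙yz≈y∙xz S _ S′ ⟩
    B 0 * f 0 + (S + S′)                                  ≈⟨ +-congˡ (sym (sumTo-+ j _ _)) ⟩
    B 0 * f 0 + sumTo j (λ k → B k * f (suc k) + B (suc k) * f (suc k)) ≈⟨ +-congˡ (sumTo-cong j combine) ⟩
    B′ 0 * f 0 + sumTo j (λ k → B′ (suc k) * f (suc k))   ≈⟨ sym (sumTo-shift j _) ⟩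
    sumTo (suc j) (λ k → B′ k * f k)                      ∎
    where
    B B′ : ℕ → Carrier
    B  = binomℕ (fromℕ j)
    B′ = binomℕ (fromℕ (suc j))
    S  = sumTo j (λ k → B k * f (suc k))
    S′ = sumTo j (λ k → B (suc k) * f (suc k))
    top : B (suc j) * f (suc j) ≈ 0#
    top = trans (*-congʳ (binomℕ-vanish j)) (zeroˡ _)
    combine : ∀ k → B k * f (suc k) + B (suc k) * f (suc k) ≈ B′ (suc k) * f (suc k)
    combine k = trans (sym (distribʳ _ _ _)) (*-congʳ (sym (pascal (fromℕ j) k)))

  absorption : ∀ z d → z * binomℕ (z - 1#) d ≈ binomℕ z d * (z - fromℕ d)
  absorption z zero = solve 1 (λ z → z :* :1 := :1 :* (z :- :0)) refl z
  absorption z (suc d) = *-cancel-suc d (begin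
    z * binomℕ (z - 1#) (suc d) * fromℕ (suc d)     ≈⟨ *-assoc _ _ _ ⟩
    z * (binomℕ (z - 1#) (suc d) * fromℕ (suc d))   ≈⟨ *-congˡ (binomℕ-step (z - 1#) d) ⟩
    z * (binomℕ (z - 1#) d * ((z - 1#) - e))        ≈⟨ sym (*-assoc _ _ _) ⟩
    z * binomℕ (z - 1#) d * ((z - 1#) - e)          ≈⟨ *-congʳ (absorption z d) ⟩
    u * (z - e) * ((z - 1#) - e)
      ≈⟨ solve 3 (λ z e u → u :* (z :- e) :* ((z :- :1) :- e) := u :* (z :- e) :* (z :- (:1 :+ e))) refl z e u ⟩
    u * (z - e) * (z - (1# + e))                    ≈⟨ *-congʳ (sym (binomℕ-step z d)) ⟩
    binomℕ z (suc d) * (1# + e) * (z - (1# + e))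
      ≈⟨ solve 3 (λ b e z → b :* (:1 :+ e) :* (z :- (:1 :+ e)) := b :* (z :- (:1 :+ e)) :* (:1 :+ e)) refl (binomℕ z (suc d)) e z ⟩
    binomℕ z (suc d) * (z - fromℕ (suc d)) * fromℕ (suc d) ∎)
    where
    e = fromℕ d
    u = binomℕ z d

  trinomial : ∀ a k d →
    binomℕ a (k ℕ.+ d) * binomℕ (fromℕ (k ℕ.+ d)) k ≈ binomℕ a k * binomℕ (a - fromℕ k) d
  trinomial a zero d = begin
    binomℕ a d * 1#        ≈⟨ *-identityʳ _ ⟩
    binomℕ a d             ≈⟨ binomℕ-cong d (solve 1 (λ a → a := a :- :0) refl a) ⟩
    binomℕ (a - 0#) d      ≈⟨ sym (*-identityˡ _) ⟩
    1# * binomℕ (a - 0#) d ∎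
  trinomial a (suc k) d = *-cancel-suc k (begin
    binomℕ a J * binomℕ (fromℕ J) (suc k) * fromℕ (suc k)   ≈⟨ *-assoc _ _ _ ⟩
    binomℕ a J * (binomℕ (fromℕ J) (suc k) * fromℕ (suc k)) ≈⟨ *-congˡ (binomℕ-step (fromℕ J) k) ⟩
    binomℕ a J * (binomℕ (fromℕ J) k * (fromℕ J - t))       ≈⟨ sym (*-assoc _ _ _) ⟩
    binomℕ a J * binomℕ (fromℕ J) k * (fromℕ J - t)
      ≈⟨ *-cong shifted (+-congʳ (+-congˡ (fromℕ-+ k d))) ⟩
    binomℕ a k * binomℕ z (suc d) * ((1# + (t + e)) - t)
      ≈⟨ solve 4 (λ x y t e → x :* y :* ((:1 :+ (t :+ e)) :- t) := x :* (y :* (:1 :+ e))) refl (binomℕ a k) (binomℕ z (suc d)) t e ⟩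
    binomℕ a k * (binomℕ z (suc d) * (1# + e))              ≈⟨ *-congˡ (binomℕ-step z d) ⟩
    binomℕ a k * (binomℕ z d * (z - e))                     ≈⟨ *-congˡ (sym (absorption z d)) ⟩
    binomℕ a k * (z * binomℕ (z - 1#) d)
      ≈⟨ *-congˡ (*-congˡ (binomℕ-cong d (solve 2 (λ a t → (a :- t) :- :1 := a :- (:1 :+ t)) refl a t))) ⟩
    binomℕ a k * ((a - t) * binomℕ (a - fromℕ (suc k)) d)
      ≈⟨ solve 3 (λ x y w → x :* (y :* w) := x :* y :* w) refl (binomℕ a k) (a - t) (binomℕ (a - fromℕ (suc k)) d) ⟩
    binomℕ a k * (a - t) * binomℕ (a - fromℕ (suc k)) d     ≈⟨ *-congʳ (sym (binomℕ-step a k)) ⟩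
    binomℕ a (suc k) * fromℕ (suc k) * binomℕ (a - fromℕ (suc k)) d
      ≈⟨ solve 3 (λ x y w → x :* y :* w := x :* w :* y) refl (binomℕ a (suc k)) (fromℕ (suc k)) (binomℕ (a - fromℕ (suc k)) d) ⟩
    binomℕ a (suc k) * binomℕ (a - fromℕ (suc k)) d * fromℕ (suc k) ∎)
    where
    J = suc (k ℕ.+ d)
    t = fromℕ k
    e = fromℕ d
    z = a - t
    -- the induction hypothesis for (k, d+1), with k + (d+1) = J
    shifted : binomℕ a J * binomℕ (fromℕ J) k ≈ binomℕ a k * binomℕ z (suc d)
    shifted = P.subst (λ J → binomℕ a J * binomℕ (fromℕ J) k ≈ binomℕ a k * binomℕ z (suc d))
                      (ℕP.+-suc k d) (trinomial a k (suc d))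

  vandermonde : ∀ j y m →
    binom (fromℕ j + y) m ≈ sumTo j (λ k → binomℕ (fromℕ j) k * binom y (m ℤ.- + k))
  vandermonde zero y m = begin
    binom (0# + y) m          ≈⟨ binom-cong m (+-identityˡ y) ⟩
    binom y m                 ≡⟨ P.cong (binom y) (P.sym (ℤP.+-identityʳ m)) ⟩
    binom y (m ℤ.- + 0)       ≈⟨ sym (*-identityˡ _) ⟩
    1# * binom y (m ℤ.- + 0)  ∎
  vandermonde (suc j) y m = begin
    binom ((1# + fromℕ j) + y) m                  ≈⟨ binom-cong m (+-assoc 1# (fromℕ j) y) ⟩
    binom (1# + X) m                              ≡⟨ P.cong (binom (1# + X)) (P.sym (ℤP.suc-pred m)) ⟩
    binom (1# + X) (ℤ.suc (ℤ.pred m))             ≈⟨ pascal-ℤ X (ℤ.pred m) ⟩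
    binom X (ℤ.pred m) + binom X (ℤ.suc (ℤ.pred m))
      ≡⟨ P.cong (λ i → binom X (ℤ.pred m) + binom X i) (ℤP.suc-pred m) ⟩
    binom X (ℤ.pred m) + binom X m                ≈⟨ +-cong (vandermonde j y (ℤ.pred m)) (vandermonde j y m) ⟩
    sumTo j (λ k → B k * binom y (ℤ.pred m ℤ.- + k)) + sumTo j (λ k → B k * f k)
      ≈⟨ +-congʳ (sumTo-cong j (λ k → *-congˡ (reflexive (P.cong (binom y) (P.sym (minus-suc m k)))))) ⟩
    sumTo j (λ k → B k * f (suc k)) + sumTo j (λ k → B k * f k) ≈⟨ pascal-sum j f ⟩
    sumTo (suc j) (λ k → binomℕ (fromℕ (suc j)) k * f k) ∎
    where
    X = fromℕ j + y
    B = binomℕ (fromℕ j)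
    f : ℕ → Carrier
    f k = binom y (m ℤ.- + k)

  trinomial-ℕ : ∀ {n j k} → k ≤ j → j ≤ n →
    binomℕ (fromℕ n) j * binomℕ (fromℕ j) k ≈ binomℕ (fromℕ n) k * binomℕ (fromℕ (n ∸ k)) (j ∸ k)
  trinomial-ℕ {n} {j} {k} k≤j j≤n = begin
    binomℕ (fromℕ n) j * binomℕ (fromℕ j) k
      ≡⟨ P.cong (λ i → binomℕ (fromℕ n) i * binomℕ (fromℕ i) k) (P.sym (ℕP.m+[n∸m]≡n k≤j)) ⟩
    binomℕ (fromℕ n) (k ℕ.+ (j ∸ k)) * binomℕ (fromℕ (k ℕ.+ (j ∸ k))) k
      ≈⟨ trinomial (fromℕ n) k (j ∸ k) ⟩
    binomℕ (fromℕ n) k * binomℕ (fromℕ n - fromℕ k) (j ∸ k)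
      ≈⟨ *-congˡ (binomℕ-cong (j ∸ k) (fromℕ-∸ (ℕP.≤-trans k≤j j≤n))) ⟩
    binomℕ (fromℕ n) k * binomℕ (fromℕ (n ∸ k)) (j ∸ k) ∎

module PartialAlternatingSum {c ℓ : Level} (A : QAlgebra c ℓ)
                             (n : ℕ) (y : CommutativeRing.Carrier (QAlgebra.commRing A)) (m : ℤ) where
  open QAlgebra A
  open CommutativeRing commRing hiding (zero)
  open QOps A
  open IntegerCast commRing
  open FiniteSums commRing
  open Binomials A
  open import Relation.Binary.Reasoning.Setoid setoid

  lhsTerm : ℕ → Carrier
  lhsTerm k = sign (n ∸ k) * binomℕ (fromℕ n) k * binom (fromℕ k + y) m

  rhsTerm : ℕ → ℕ → Carrier
  rhsTerm n₁ k = sign (n ∸ n₁) * binomℕ (fromℕ n) k * binom y (m ℤ.- + k)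
                 * binom (fromℤ (+ n ℤ.- + k ℤ.- + 1)) (+ n₁ ℤ.- + k)

  -- (-1)^{n-j} C(n,k) C(y, m-k) C(n-k, j-k): the summands of lhsTerm j
  -- after Vandermonde's convolution and trinomial revision
  expansionTerm : ℕ → ℕ → Carrier
  expansionTerm j k = sign (n ∸ j) * binomℕ (fromℕ n) k * binom y (m ℤ.- + k)
                      * binomℕ (fromℕ (n ∸ k)) (j ∸ k)

  sign-step : ∀ {j} → suc j ≤ n → sign (n ∸ j) ≈ - sign (n ∸ suc j)
  sign-step {j} j<n = reflexive (P.cong sign (ℕP.+-∸-assoc 1 j<n))

  lhsTerm-expansion : ∀ j → j ≤ n → lhsTerm j ≈ sumTo j (expansionTerm j)
  lhsTerm-expansion j j≤n = begin
    s * binomℕ (fromℕ n) j * binom (fromℕ j + y) m                   ≈⟨ *-congˡ (vandermonde j y m) ⟩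
    s * binomℕ (fromℕ n) j * sumTo j (λ k → binomℕ (fromℕ j) k * Z k) ≈⟨ sumTo-*ˡ j _ _ ⟩
    sumTo j (λ k → s * binomℕ (fromℕ n) j * (binomℕ (fromℕ j) k * Z k)) ≈⟨ sumTo-cong≤ j regroup ⟩
    sumTo j (expansionTerm j)                                        ∎
    where
    s = sign (n ∸ j)
    Z : ℕ → Carrier
    Z k = binom y (m ℤ.- + k)
    regroup : ∀ k → k ≤ j → s * binomℕ (fromℕ n) j * (binomℕ (fromℕ j) k * Z k) ≈ expansionTerm j k
    regroup k k≤j = begin
      s * binomℕ (fromℕ n) j * (binomℕ (fromℕ j) k * Z k)
        ≈⟨ solve 4 (λ s a b z → s :* a :* (b :* z) := s :* (a :* b) :* z) refl s _ _ (Z k) ⟩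
      s * (binomℕ (fromℕ n) j * binomℕ (fromℕ j) k) * Z k
        ≈⟨ *-congʳ (*-congˡ (trinomial-ℕ k≤j j≤n)) ⟩
      s * (binomℕ (fromℕ n) k * E) * Z k
        ≈⟨ solve 4 (λ s a e z → s :* (a :* e) :* z := s :* a :* z :* e) refl s _ E (Z k) ⟩
      expansionTerm j k ∎
      where
      E = binomℕ (fromℕ (n ∸ k)) (j ∸ k)

  -- the summand k = n₁ + 1 of the right-hand side carries C(·, -1) = 0
  rhsTerm-beyond : ∀ n₁ → rhsTerm n₁ (suc n₁) ≈ 0#
  rhsTerm-beyond n₁ = P.subst (λ i → rhsTerm′ i ≈ 0#) (P.sym (minus-next n₁)) (zeroʳ _)
    where
    rhsTerm′ : ℤ → Carrier
    rhsTerm′ i = sign (n ∸ n₁) * binomℕ (fromℕ n) (suc n₁) * binom y (m ℤ.- + suc n₁)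
                 * binom (fromℤ (+ n ℤ.- + suc n₁ ℤ.- + 1)) i

  -- one step in n₁, summand by summand: Pascal's rule on C(n-k, n₁+1-k)
  rhsTerm-step : ∀ n₁ k → k ≤ suc n₁ → suc n₁ ≤ n →
    rhsTerm n₁ k + expansionTerm (suc n₁) k ≈ rhsTerm (suc n₁) k
  rhsTerm-step n₁ k k≤1+n₁ 1+n₁≤n = begin
    sign (n ∸ n₁) * b * z * F + s * b * z * E
      ≈⟨ +-cong (*-congʳ (*-congʳ (*-congʳ (sign-step 1+n₁≤n)))) (*-congˡ split) ⟩
    - s * b * z * F + s * b * z * (F + D)
      ≈⟨ solve 5 (λ s b z f d → :- s :* b :* z :* f :+ s :* b :* z :* (f :+ d) := s :* b :* z :* d) refl s b z F D ⟩
    s * b * z * D                             ≡⟨ P.cong (λ i → s * b * z * binom T i) (suc-minus n₁ k) ⟩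
    rhsTerm (suc n₁) k                        ∎
    where
    s = sign (n ∸ suc n₁)
    b = binomℕ (fromℕ n) k
    z = binom y (m ℤ.- + k)
    T = fromℤ (+ n ℤ.- + k ℤ.- + 1)
    E = binomℕ (fromℕ (n ∸ k)) (suc n₁ ∸ k)
    F = binom T (+ n₁ ℤ.- + k)
    D = binom T (ℤ.suc (+ n₁ ℤ.- + k))
    top : 1# + T ≈ fromℕ (n ∸ k)
    top = P.subst (λ i → 1# + fromℤ (i ℤ.- + 1) ≈ fromℕ (n ∸ k))
                  (P.sym (minus-≥ (ℕP.≤-trans k≤1+n₁ 1+n₁≤n))) (fromℤ-pred (+ (n ∸ k)))
    split : E ≈ F + D
    split = begin
      binomℕ (fromℕ (n ∸ k)) (suc n₁ ∸ k)       ≈⟨ binomℕ-cong (suc n₁ ∸ k) (sym top) ⟩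
      binom (1# + T) (+ (suc n₁ ∸ k))
        ≡⟨ P.cong (binom (1# + T)) (P.trans (P.sym (minus-≥ k≤1+n₁)) (P.sym (suc-minus n₁ k))) ⟩
      binom (1# + T) (ℤ.suc (+ n₁ ℤ.- + k))     ≈⟨ pascal-ℤ T (+ n₁ ℤ.- + k) ⟩
      F + D                                     ∎

  partial-sum : ∀ n₁ → n₁ ≤ n → sumTo n₁ lhsTerm ≈ sumTo n₁ (rhsTerm n₁)
  partial-sum zero _ = begin
    sign n * 1# * binom (0# + y) m      ≈⟨ *-congˡ (binom-cong m (+-identityˡ y)) ⟩
    sign n * 1# * binom y m             ≡⟨ P.cong (λ i → sign n * 1# * binom y i) (P.sym (ℤP.+-identityʳ m)) ⟩
    sign n * 1# * binom y (m ℤ.- + 0)   ≈⟨ sym (*-identityʳ _) ⟩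
    rhsTerm 0 0                         ∎
  partial-sum (suc n₁) j≤n = begin
    sumTo n₁ lhsTerm + lhsTerm j
      ≈⟨ +-cong (partial-sum n₁ (ℕP.≤-trans (ℕP.n≤1+n n₁) j≤n)) (lhsTerm-expansion j j≤n) ⟩
    sumTo n₁ (rhsTerm n₁) + sumTo j (expansionTerm j)
      ≈⟨ +-congʳ (sym (sumTo-dropLast n₁ (rhsTerm n₁) (rhsTerm-beyond n₁))) ⟩
    sumTo j (rhsTerm n₁) + sumTo j (expansionTerm j)      ≈⟨ sym (sumTo-+ j _ _) ⟩
    sumTo j (λ k → rhsTerm n₁ k + expansionTerm j k)
      ≈⟨ sumTo-cong≤ j (λ k k≤j → rhsTerm-step n₁ k k≤j j≤n) ⟩
    sumTo j (rhsTerm j)                                   ∎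
    where
    j = suc n₁

corollary3p2 : {c ℓ : Level} (A : QAlgebra c ℓ) →
  let open QAlgebra A
      open CommutativeRing commRing
      open QOps A
  in (q n n₁ : ℕ) → n₁ ≤ n → (x : Carrier) →
     sumTo n₁ (λ k → sign (n ∸ k) * binom (fromℕ n) (+ k)
         * binom (fromℕ k + x + fromℤ ((+ q) ℤ.+ (+ n) ℤ.- (+ 2))) ((+ q) ℤ.+ (+ n) ℤ.- (+ 1)))
     ≈ sumTo n₁ (λ k → sign (n ∸ n₁) * binom (fromℕ n) (+ k)
         * binom (x + fromℤ ((+ q) ℤ.+ (+ n) ℤ.- (+ 2))) ((+ q) ℤ.+ (+ n) ℤ.- (+ 1) ℤ.- (+ k))
         * binom (fromℤ ((+ n) ℤ.- (+ k) ℤ.- (+ 1))) ((+ n₁) ℤ.- (+ k)))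
-- the case y = x + (q+n-2), m = q+n-1 of the partial sum identity; only the
-- reassociation (k + x) + (q+n-2) = k + (x + (q+n-2)) is needed
corollary3p2 A q n n₁ n₁≤n x =
  trans (sumTo-cong n₁ (λ k → *-congˡ (binom-cong m (+-assoc (fromℕ k) x w))))
        (partial-sum n₁ n₁≤n)
  where
  open QAlgebra A
  open CommutativeRing commRing
  open QOps A
  open FiniteSums commRing
  open Binomials A
  w = fromℤ ((+ q) ℤ.+ (+ n) ℤ.- (+ 2))
  m = (+ q) ℤ.+ (+ n) ℤ.- (+ 1)
  open PartialAlternatingSum A n (x + w) m
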